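{- Let $\mathsf{C}$ be a conceptual structures category and let $\mathsf{Adj}(\mathsf{C})_{=}$ be the category of posetal $\mathsf{C}$-objects and $\mathsf{C}$-adjunctions between them. Then the arrow category $\mathsf{Adj}(\mathsf{C})_{=}^{\mathsf{2}}$ is equivalent to the reflection–coreflection factorization category $\mathsf{Ref}(\mathsf{C}) \odot \mathsf{Ref}(\mathsf{C})^\propto$.
   Context: Composition is diagrammatic: $f \cdot g$ means first $f$, then $g$. A conceptual structures (CS) category is an order-enriched category (hom-sets are preorders, composition monotone) with finite limits. An object $A$ is posetal if each hom-preorder $\mathsf{C}(X,A)$ is a partial order. A $\mathsf{C}$-adjunction $g = \langle \check g, \hat g\rangle : A \rightleftharpoons B$ has $\check g : A \rightarrow B$, $\hat g : B \rightarrow A$ with $1_A \leq \check g\cdot\hat g$ and $\hat g \cdot\check g \leq 1_B$; adjunctions compose componentwise, $g \circ h = \langle \check g\cdot\check h, \hat h\cdot\hat g\rangle$. A reflection is an adjunction with $\hat g\cdot\check g = 1_B$; a coreflection one with $\check g \cdot \hat g = 1_A$. $\mathsf{Ref}(\mathsf{C})$ and $\mathsf{Ref}(\mathsf{C})^\propto$ denote the classes of reflections and coreflections between posetal objects. The arrow category $\mathsf{Adj}(\mathsf{C})_{=}^{\mathsf{2}}$ has objects $(A,g,B)$ with $g : A \rightleftharpoons B$ in $\mathsf{Adj}(\mathsf{C})_{=}$, and morphisms $(a,b) : (A_1,g_1,B_1) \rightarrow (A_2,g_2,B_2)$ pairs of adjunctions $a : A_1 \rightleftharpoons A_2$, $b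 : B_1 \rightleftharpoons B_2$ with $a \circ g_2 = g_1 \circ b$. The category $\mathsf{Ref}(\mathsf{C}) \odot \mathsf{Ref}(\mathsf{C})^\propto$ has objects $(A,e,C,m,B)$ with $e : A \rightleftharpoons C$ a reflection and $m : C \rightleftharpoons B$ a coreflection (objects posetal), and morphisms $(a,c,b) : (A_1,e_1,C_1,m_1,B_1) \rightarrow (A_2,e_2,C_2,m_2,B_2)$ triples of adjunctions with $a\circ e_2 = e_1 \circ c$ and $c \circ m_2 = m_1\circ b$. -}

module Defs where

open import Level using (Level; _⊔_) renaming (suc to lsuc)
open import Relation.Binary.PropositionalEquality using (_≡_; refl; sym; trans; cong; cong₂; subst)
open import Data.Product using (Σ; _×_; _,_; proj₁; proj₂)

-- Generic (1-)categories, with a setoid equality on hom-sets and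
-- DIAGRAMMATIC composition  f · g  = "first f, then g".

record Category (o ℓ e : Level) : Set (lsuc (o ⊔ ℓ ⊔ e)) where
  infixr 9 _·_
  infix 4 _≈_
  field
    Obj : Set o
    _⇒_ : Obj → Obj → Set ℓ
    _≈_ : ∀ {A B} → A ⇒ B → A ⇒ B → Set e
    id  : ∀ {A} → A ⇒ A
    _·_ : ∀ {A B C} → A ⇒ B → B ⇒ C → A ⇒ C
    ≈-refl  : ∀ {A B} {f : A ⇒ B} → f ≈ f
    ≈-sym   : ∀ {A B} {f g : A ⇒ B} → f ≈ g → g ≈ f
    ≈-trans : ∀ {A B} {f g h : A ⇒ B} → f ≈ g → g ≈ h → f ≈ h
    ·-resp-≈ : ∀ {A B C} {f h : A ⇒ B} {g i : B ⇒ C} → f ≈ h → g ≈ i → f · g ≈ h · i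
    assoc : ∀ {A B C D} {f : A ⇒ B} {g : B ⇒ C} {h : C ⇒ D} → (f · g) · h ≈ f · (g · h)
    identityˡ : ∀ {A B} {f : A ⇒ B} → id · f ≈ f
    identityʳ : ∀ {A B} {f : A ⇒ B} → f · id ≈ f

record Functor {o ℓ e o′ ℓ′ e′} (C : Category o ℓ e) (D : Category o′ ℓ′ e′)
       : Set (o ⊔ ℓ ⊔ e ⊔ o′ ⊔ ℓ′ ⊔ e′) where
  private
    module C = Category C
    module D = Category D
  field
    F₀ : C.Obj → D.Obj
    F₁ : ∀ {A B} → A C.⇒ B → F₀ A D.⇒ F₀ B
    identity : ∀ {A} → F₁ (C.id {A}) D.≈ D.id
    homomorphism : ∀ {A B E} {f : A C.⇒ B} {g : B C.⇒ E} → F₁ (f C.· g) D.≈ F₁ f D.· F₁ g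
    F-resp-≈ : ∀ {A B} {f g : A C.⇒ B} → f C.≈ g → F₁ f D.≈ F₁ g

idF : ∀ {o ℓ e} {C : Category o ℓ e} → Functor C C
idF {C = C} = record
  { F₀ = λ A → A ; F₁ = λ f → f ; identity = ≈-refl
  ; homomorphism = ≈-refl ; F-resp-≈ = λ p → p }
  where open Category C

_⨾F_ : ∀ {o ℓ e o′ ℓ′ e′ o″ ℓ″ e″}
         {C : Category o ℓ e} {D : Category o′ ℓ′ e′} {E : Category o″ ℓ″ e″}
       → Functor C D → Functor D E → Functor C E
_⨾F_ {E = E} F G = record
  { F₀ = λ A → G.F₀ (F.F₀ A)
  ; F₁ = λ f → G.F₁ (F.F₁ f)
  ; identity = E.≈-trans (G.F-resp-≈ F.identity) G.identity
  ; homomorphism = E.≈-trans (G.F-resp-≈ F.homomorphism) G.homomorphism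
  ; F-resp-≈ = λ p → G.F-resp-≈ (F.F-resp-≈ p) }
  where
    module F = Functor F
    module G = Functor G
    module E = Category E

record NaturalIsomorphism {o ℓ e o′ ℓ′ e′} {C : Category o ℓ e} {D : Category o′ ℓ′ e′}
       (F G : Functor C D) : Set (o ⊔ ℓ ⊔ e ⊔ o′ ⊔ ℓ′ ⊔ e′) where
  private
    module C = Category C
    module D = Category D
    module F = Functor F
    module G = Functor G
  field
    η   : ∀ X → F.F₀ X D.⇒ G.F₀ X
    η⁻¹ : ∀ X → G.F₀ X D.⇒ F.F₀ X
    isoˡ : ∀ X → η X D.· η⁻¹ X D.≈ D.id
    isoʳ : ∀ X → η⁻¹ X D.· η X D.≈ D.id
    natural : ∀ {X Y} (f : X C.⇒ Y) → F.F₁ f D.· η Y D.≈ η X D.· G.F₁ f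

record Equivalence {o ℓ e o′ ℓ′ e′} (C : Category o ℓ e) (D : Category o′ ℓ′ e′)
       : Set (o ⊔ ℓ ⊔ e ⊔ o′ ⊔ ℓ′ ⊔ e′) where
  field
    F : Functor C D
    G : Functor D C
    unit   : NaturalIsomorphism (idF {C = C}) (F ⨾F G)
    counit : NaturalIsomorphism (G ⨾F F) (idF {C = D})

module _ {o ℓ e} (C : Category o ℓ e) where
  open Category C

  private
    square-comp : ∀ {A₁ A₂ A₃ B₁ B₂ B₃}
      {g₁ : A₁ ⇒ B₁} {g₂ : A₂ ⇒ B₂} {g₃ : A₃ ⇒ B₃}
      {a : A₁ ⇒ A₂} {b : B₁ ⇒ B₂} {a′ : A₂ ⇒ A₃} {b′ : B₂ ⇒ B₃}
      → a · g₂ ≈ g₁ · b → a′ · g₃ ≈ g₂ · b′ → (a · a′) · g₃ ≈ g₁ · (b · b′)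
    square-comp s₁ s₂ =
      ≈-trans assoc (≈-trans (·-resp-≈ ≈-refl s₂) (≈-trans (≈-sym assoc)
        (≈-trans (·-resp-≈ s₁ ≈-refl) assoc)))

    square-id : ∀ {A B} {g : A ⇒ B} → id · g ≈ g · id
    square-id = ≈-trans identityˡ (≈-sym identityʳ)

  record ArrowObj : Set (o ⊔ ℓ) where
    constructor arrObj
    field
      dom cod : Obj
      arr : dom ⇒ cod

  record ArrowHom (X Y : ArrowObj) : Set (ℓ ⊔ e) where
    constructor arrHom
    private
      module X = ArrowObj X
      module Y = ArrowObj Y
    field
      top : X.dom ⇒ Y.dom
      bot : X.cod ⇒ Y.cod
      commute : top · Y.arr ≈ X.arr · bot

  Arrow : Category (o ⊔ ℓ) (ℓ ⊔ e) e
  Arrow = record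
    { Obj = ArrowObj
    ; _⇒_ = ArrowHom
    ; _≈_ = λ f g → (ArrowHom.top f ≈ ArrowHom.top g) × (ArrowHom.bot f ≈ ArrowHom.bot g)
    ; id = arrHom id id square-id
    ; _·_ = λ (arrHom a b s) (arrHom a′ b′ s′) → arrHom (a · a′) (b · b′) (square-comp s s′)
    ; ≈-refl = ≈-refl , ≈-refl
    ; ≈-sym = λ (p , q) → ≈-sym p , ≈-sym q
    ; ≈-trans = λ (p , q) (p′ , q′) → ≈-trans p p′ , ≈-trans q q′
    ; ·-resp-≈ = λ (p , q) (p′ , q′) → ·-resp-≈ p p′ , ·-resp-≈ q q′
    ; assoc = assoc , assoc
    ; identityˡ = identityˡ , identityˡ
    ; identityʳ = identityʳ , identityʳ
    }

  module _ {p q} (E : ∀ {A B} → A ⇒ B → Set p) (M : ∀ {A B} → A ⇒ B → Set q) where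

    record FactObj : Set (o ⊔ ℓ ⊔ p ⊔ q) where
      constructor factObj
      field
        dom mid cod : Obj
        left  : dom ⇒ mid
        right : mid ⇒ cod
        left∈E  : E left
        right∈M : M right

    record FactHom (X Y : FactObj) : Set (ℓ ⊔ e) where
      constructor factHom
      private
        module X = FactObj X
        module Y = FactObj Y
      field
        hdom : X.dom ⇒ Y.dom
        hmid : X.mid ⇒ Y.mid
        hcod : X.cod ⇒ Y.cod
        commuteˡ : hdom · Y.left  ≈ X.left  · hmid
        commuteʳ : hmid · Y.right ≈ X.right · hcod

    Factorizations : Category (o ⊔ ℓ ⊔ p ⊔ q) (ℓ ⊔ e) e
    Factorizations = record
      { Obj = FactObj
      ; _⇒_ = FactHom
      ; _≈_ = λ f g → (FactHom.hdom f ≈ FactHom.hdom g)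
                    × (FactHom.hmid f ≈ FactHom.hmid g)
                    × (FactHom.hcod f ≈ FactHom.hcod g)
      ; id = factHom id id id square-id square-id
      ; _·_ = λ (factHom a c b s t) (factHom a′ c′ b′ s′ t′) →
                factHom (a · a′) (c · c′) (b · b′) (square-comp s s′) (square-comp t t′)
      ; ≈-refl = ≈-refl , ≈-refl , ≈-refl
      ; ≈-sym = λ (p , q , r) → ≈-sym p , ≈-sym q , ≈-sym r
      ; ≈-trans = λ (p , q , r) (p′ , q′ , r′) → ≈-trans p p′ , ≈-trans q q′ , ≈-trans r r′
      ; ·-resp-≈ = λ (p , q , r) (p′ , q′ , r′) → ·-resp-≈ p p′ , ·-resp-≈ q q′ , ·-resp-≈ r r′
      ; assoc = assoc , assoc , assoc
      ; identityˡ = identityˡ , identityˡ , identityˡ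
      ; identityʳ = identityʳ , identityʳ , identityʳ
      }

record OrderEnrichedCategory (o ℓ r : Level) : Set (lsuc (o ⊔ ℓ ⊔ r)) where
  infixr 9 _·_
  infix 4 _≤_
  field
    Obj : Set o
    Hom : Obj → Obj → Set ℓ
    _≤_ : ∀ {A B} → Hom A B → Hom A B → Set r
    id  : ∀ {A} → Hom A A
    _·_ : ∀ {A B C} → Hom A B → Hom B C → Hom A C
    ·-assoc : ∀ {A B C D} {f : Hom A B} {g : Hom B C} {h : Hom C D} → (f · g) · h ≡ f · (g · h)
    ·-identityˡ : ∀ {A B} {f : Hom A B} → id · f ≡ f
    ·-identityʳ : ∀ {A B} {f : Hom A B} → f · id ≡ f
    ≤-refl  : ∀ {A B} {f : Hom A B} → f ≤ f
    ≤-trans : ∀ {A B} {f g h : Hom A B} → f ≤ g → g ≤ h → f ≤ h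
    ·-mono  : ∀ {A B C} {f f′ : Hom A B} {g g′ : Hom B C} → f ≤ f′ → g ≤ g′ → f · g ≤ f′ · g′

module _ {o ℓ r} (C : OrderEnrichedCategory o ℓ r) where
  open OrderEnrichedCategory C

  -- Finite (conical, order-enriched) limits: the limit cone induces an
  -- isomorphism of hom-PREORDERS, i.e. also reflects the order.
  record Terminal : Set (o ⊔ ℓ) where
    field
      ⊤ : Obj
      ! : ∀ {X} → Hom X ⊤
      !-unique : ∀ {X} (f : Hom X ⊤) → f ≡ !

  record BinaryProducts : Set (o ⊔ ℓ ⊔ r) where
    field
      _×ₒ_ : Obj → Obj → Obj
      π₁ : ∀ {A B} → Hom (A ×ₒ B) A
      π₂ : ∀ {A B} → Hom (A ×ₒ B) B
      ⟨_,_⟩ : ∀ {X A B} → Hom X A → Hom X B → Hom X (A ×ₒ B)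
      project₁ : ∀ {X A B} {f : Hom X A} {g : Hom X B} → ⟨ f , g ⟩ · π₁ ≡ f
      project₂ : ∀ {X A B} {f : Hom X A} {g : Hom X B} → ⟨ f , g ⟩ · π₂ ≡ g
      unique : ∀ {X A B} {f : Hom X A} {g : Hom X B} {h : Hom X (A ×ₒ B)}
             → h · π₁ ≡ f → h · π₂ ≡ g → h ≡ ⟨ f , g ⟩
      reflect-≤ : ∀ {X A B} {h k : Hom X (A ×ₒ B)}
             → h · π₁ ≤ k · π₁ → h · π₂ ≤ k · π₂ → h ≤ k

  record Equalizer {A B : Obj} (f g : Hom A B) : Set (o ⊔ ℓ ⊔ r) where
    field
      obj : Obj
      arr : Hom obj A
      equality : arr · f ≡ arr · g
      factor : ∀ {X} (h : Hom X A) → h · f ≡ h · g → Hom X obj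
      factor-eq : ∀ {X} {h : Hom X A} (eq : h · f ≡ h · g) → factor h eq · arr ≡ h
      unique : ∀ {X} {h : Hom X A} {u : Hom X obj} (eq : h · f ≡ h · g) → u · arr ≡ h → u ≡ factor h eq
      reflect-≤ : ∀ {X} {u v : Hom X obj} → u · arr ≤ v · arr → u ≤ v

  IsPosetal : Obj → Set (o ⊔ ℓ ⊔ r)
  IsPosetal A = ∀ {X} {f g : Hom X A} → f ≤ g → g ≤ f → f ≡ g

  record Adjunction (A B : Obj) : Set (ℓ ⊔ r) where
    constructor adj
    field
      check : Hom A B
      hat   : Hom B A
      unit   : id ≤ check · hat
      counit : hat · check ≤ id

  private
    ≤-≡ʳ : ∀ {A B} {f g h : Hom A B} → f ≤ g → g ≡ h → f ≤ h
    ≤-≡ʳ p refl = p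
    ≤-≡ˡ : ∀ {A B} {f g h : Hom A B} → f ≡ g → g ≤ h → f ≤ h
    ≤-≡ˡ refl p = p

  idAdj : ∀ {A} → Adjunction A A
  idAdj = adj id id (≤-≡ʳ ≤-refl (sym ·-identityˡ)) (≤-≡ˡ ·-identityˡ ≤-refl)

  _∘ₐ_ : ∀ {A B D} → Adjunction A B → Adjunction B D → Adjunction A D
  adj gc gh gu gcu ∘ₐ adj hc hh hu hcu = adj (gc · hc) (hh · gh) u cu
    where
      u = ≤-trans gu (≤-≡ˡ (cong (_· gh) (sym ·-identityʳ))
            (≤-≡ʳ (·-mono (·-mono ≤-refl hu) ≤-refl)
              (trans (cong (_· gh) (sym ·-assoc)) ·-assoc)))
      cu = ≤-trans (≤-≡ˡ (trans (sym ·-assoc) (cong (_· hc) ·-assoc))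
             (·-mono (·-mono ≤-refl gcu) ≤-refl))
             (≤-≡ˡ (cong (_· hc) ·-identityʳ) hcu)

  IsReflection : ∀ {A B} → Adjunction A B → Set ℓ
  IsReflection g = Adjunction.hat g · Adjunction.check g ≡ id

  IsCoreflection : ∀ {A B} → Adjunction A B → Set ℓ
  IsCoreflection g = Adjunction.check g · Adjunction.hat g ≡ id

  AdjCat : Category (o ⊔ ℓ ⊔ r) (ℓ ⊔ r) ℓ
  AdjCat = record
    { Obj = Σ Obj IsPosetal
    ; _⇒_ = λ A B → Adjunction (proj₁ A) (proj₁ B)
    ; _≈_ = λ g h → (Adjunction.check g ≡ Adjunction.check h) × (Adjunction.hat g ≡ Adjunction.hat h)
    ; id = idAdj
    ; _·_ = _∘ₐ_
    ; ≈-refl = refl , refl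
    ; ≈-sym = λ (p , q) → sym p , sym q
    ; ≈-trans = λ (p , q) (p′ , q′) → trans p p′ , trans q q′
    ; ·-resp-≈ = λ (p , q) (p′ , q′) → cong₂ _·_ p p′ , cong₂ _·_ q′ q
    ; assoc = ·-assoc , sym ·-assoc
    ; identityˡ = ·-identityˡ , ·-identityʳ
    ; identityʳ = ·-identityʳ , ·-identityˡ
    }

  AdjArrow : Category (o ⊔ ℓ ⊔ r) (ℓ ⊔ r) ℓ
  AdjArrow = Arrow AdjCat

  RefCoref : Category (o ⊔ ℓ ⊔ r) (ℓ ⊔ r) ℓ
  RefCoref = Factorizations AdjCat IsReflection IsCoreflection

record CSCategory (o ℓ r : Level) : Set (lsuc (o ⊔ ℓ ⊔ r)) where
  field
    cat : OrderEnrichedCategory o ℓ r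
    terminal : Terminal cat
    products : BinaryProducts cat
    equalizers : ∀ {A B} (f g : OrderEnrichedCategory.Hom cat A B) → Equalizer cat f g

-- An adjunction g between posetal objects satisfies ǧ·ĝ·ǧ = ǧ and ĝ·ǧ·ĝ = ĝ, so its
-- closure ǧ·ĝ is an idempotent (and inflationary) endomorphism. Splitting it, which the
-- finite limits allow (equalizer of the closure with the identity), factors g as a
-- reflection onto the object of closed elements followed by a coreflection. A morphism
-- of adjunctions restricts to these splittings, which makes the factorization a
-- functor; composing the two factors is its inverse, since any two splittings of the
-- same idempotent are canonically isomorphic.
module Submission where

open import Level using (_⊔_)
open import Data.Product using (_×_; _,_; proj₁; proj₂)
open import Relation.Binary.PropositionalEquality
  using (_≡_; refl; sym; trans; cong; module ≡-Reasoning)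

open import Defs

module _ {o ℓ e} (D : Category o ℓ e) where
  open Category D

  paste : ∀ {A₁ A₂ C₁ C₂ B₁ B₂} {a : A₁ ⇒ A₂} {c : C₁ ⇒ C₂} {b : B₁ ⇒ B₂}
            {e₁ : A₁ ⇒ C₁} {e₂ : A₂ ⇒ C₂} {m₁ : C₁ ⇒ B₁} {m₂ : C₂ ⇒ B₂}
        → a · e₂ ≈ e₁ · c → c · m₂ ≈ m₁ · b → a · (e₂ · m₂) ≈ (e₁ · m₁) · b
  paste left right =
    ≈-trans (≈-sym assoc) (≈-trans (·-resp-≈ left ≈-refl)
      (≈-trans assoc (≈-trans (·-resp-≈ ≈-refl right) (≈-sym assoc))))

  composite : ∀ {p q} (E : ∀ {A B} → A ⇒ B → Set p) (M : ∀ {A B} → A ⇒ B → Set q)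
            → Functor (Factorizations D E M) (Arrow D)
  composite E M = record
    { F₀ = λ X → arrObj (FactObj.dom X) (FactObj.cod X) (FactObj.left X · FactObj.right X)
    ; F₁ = λ f → arrHom (FactHom.hdom f) (FactHom.hcod f)
                   (paste (FactHom.commuteˡ f) (FactHom.commuteʳ f))
    ; identity = ≈-refl , ≈-refl
    ; homomorphism = ≈-refl , ≈-refl
    ; F-resp-≈ = λ (p , _ , q) → p , q
    }

module _ {o ℓ r} (𝒞 : OrderEnrichedCategory o ℓ r) where
  open OrderEnrichedCategory 𝒞
  open Adjunction using (check; hat; unit; counit)
  open ≡-Reasoning

  private
    variable
      A A₁ A₂ A₃ B B₁ B₂ C D : Obj

    _∘_ : Adjunction 𝒞 A B → Adjunction 𝒞 B C → Adjunction 𝒞 A C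
    _∘_ = _∘ₐ_ 𝒞

  ·-congˡ : {f : Hom A B} {g h : Hom B C} → g ≡ h → f · g ≡ f · h
  ·-congˡ = cong (_ ·_)

  ·-congʳ : {f g : Hom A B} {h : Hom B C} → f ≡ g → f · h ≡ g · h
  ·-congʳ = cong (_· _)

  pullˡ : {f : Hom A B} {g : Hom B C} {h : Hom A C} {k : Hom C D}
        → f · g ≡ h → f · (g · k) ≡ h · k
  pullˡ eq = trans (sym ·-assoc) (·-congʳ eq)

  pullʳ : {f : Hom A B} {g : Hom B C} {k : Hom C D} {h : Hom B D}
        → g · k ≡ h → (f · g) · k ≡ f · h
  pullʳ eq = trans ·-assoc (·-congˡ eq)

  cancelˡ : {f : Hom A B} {g : Hom B A} {k : Hom A C} → f · g ≡ id → f · (g · k) ≡ k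
  cancelˡ eq = trans (pullˡ eq) ·-identityˡ

  cancelʳ : {f : Hom A B} {g : Hom B C} {k : Hom C B} → g · k ≡ id → (f · g) · k ≡ f
  cancelʳ eq = trans (pullʳ eq) ·-identityʳ

  id-square : {f g : Hom A B} → f ≡ g → id · f ≡ g · id
  id-square f≡g = trans ·-identityˡ (trans f≡g (sym ·-identityʳ))

  id-comm : {f : Hom A B} → f · id ≡ id · f
  id-comm = sym (id-square refl)

  ≤-reflexive : {f g : Hom A B} → f ≡ g → f ≤ g
  ≤-reflexive refl = ≤-refl

  ≤-respˡ-≡ : {f g h : Hom A B} → f ≡ g → f ≤ h → g ≤ h
  ≤-respˡ-≡ refl f≤h = f≤h

  ≤-respʳ-≡ : {f g h : Hom A B} → g ≡ h → f ≤ g → f ≤ h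
  ≤-respʳ-≡ refl f≤g = f≤g

  record Splitting {A : Obj} (p : Hom A A) : Set (o ⊔ ℓ) where
    field
      obj  : Obj
      incl : Hom obj A
      retr : Hom A obj
      incl-retr : incl · retr ≡ id
      retr-incl : retr · incl ≡ p

    incl-idem : incl · p ≡ incl
    incl-idem = trans (·-congˡ (sym retr-incl)) (cancelˡ incl-retr)

    idem-retr : p · retr ≡ retr
    idem-retr = trans (·-congʳ (sym retr-incl)) (cancelʳ incl-retr)

    incl-monic : ∀ {X} {u v : Hom X obj} → u · incl ≡ v · incl → u ≡ v
    incl-monic {u = u} {v} eq = begin
      u                  ≡⟨ sym (cancelʳ incl-retr) ⟩
      (u · incl) · retr  ≡⟨ ·-congʳ eq ⟩
      (v · incl) · retr  ≡⟨ cancelʳ incl-retr ⟩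
      v                  ∎

  open Splitting

  equalizer-splitting : {p : Hom A A} → p · p ≡ p → Equalizer 𝒞 p id → Splitting p
  equalizer-splitting {p = p} idem E = record
    { obj = Equalizer.obj E
    ; incl = Equalizer.arr E
    ; retr = factor p p-equalizes
    -- incl · retr and id both factor incl through the equalizer
    ; incl-retr = trans (unique equality (trans (pullʳ (factor-eq p-equalizes)) incl-fixed))
                        (sym (unique equality ·-identityˡ))
    ; retr-incl = factor-eq p-equalizes
    }
    where
      open Equalizer E using (equality; factor; factor-eq; unique)
      p-equalizes : p · p ≡ p · id
      p-equalizes = trans idem (sym ·-identityʳ)
      incl-fixed : Equalizer.arr E · p ≡ Equalizer.arr E
      incl-fixed = trans equality ·-identityʳ

  splitting-posetal : {p : Hom A A} → IsPosetal 𝒞 A → (S : Splitting p) → IsPosetal 𝒞 (obj S)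
  splitting-posetal posA S u≤v v≤u =
    incl-monic S (posA (·-mono u≤v ≤-refl) (·-mono v≤u ≤-refl))

  closure : Adjunction 𝒞 A B → Hom A A
  closure g = check g · hat g

  closure-check : IsPosetal 𝒞 B → (g : Adjunction 𝒞 A B) → closure g · check g ≡ check g
  closure-check posB g = posB
    (≤-respˡ-≡ (sym ·-assoc) (≤-respʳ-≡ ·-identityʳ (·-mono ≤-refl (counit g))))
    (≤-respˡ-≡ ·-identityˡ (·-mono (unit g) ≤-refl))

  hat-closure : IsPosetal 𝒞 A → (g : Adjunction 𝒞 A B) → hat g · closure g ≡ hat g
  hat-closure posA g = posA
    (≤-respˡ-≡ ·-assoc (≤-respʳ-≡ ·-identityˡ (·-mono (counit g) ≤-refl)))
    (≤-respˡ-≡ ·-identityʳ (·-mono ≤-refl (unit g)))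

  closure-idem : IsPosetal 𝒞 A → (g : Adjunction 𝒞 A B) → closure g · closure g ≡ closure g
  closure-idem posA g = pullʳ (hat-closure posA g)

  splitting-reflection : {p : Hom A A} → id ≤ p → (S : Splitting p) → Adjunction 𝒞 A (obj S)
  splitting-reflection id≤p S =
    adj (retr S) (incl S) (≤-respʳ-≡ (sym (retr-incl S)) id≤p) (≤-reflexive (incl-retr S))

  module _ (g : Adjunction 𝒞 A B) (S : Splitting (closure g)) where

    image-coreflection-retracts : (incl S · check g) · (hat g · retr S) ≡ id
    image-coreflection-retracts = begin
      (incl S · check g) · (hat g · retr S)  ≡⟨ pullʳ (pullˡ refl) ⟩
      incl S · (closure g · retr S)          ≡⟨ ·-congˡ (idem-retr S) ⟩
      incl S · retr S                        ≡⟨ incl-retr S ⟩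
      id                                     ∎

    image-coreflection : IsPosetal 𝒞 B → Adjunction 𝒞 (obj S) B
    image-coreflection posB =
      adj (incl S · check g) (hat g · retr S)
          (≤-reflexive (sym image-coreflection-retracts))
          (≤-respˡ-≡ (sym collapse) (counit g))
      where
        collapse : (hat g · retr S) · (incl S · check g) ≡ hat g · check g
        collapse = pullʳ (trans (pullˡ (retr-incl S)) (closure-check posB g))

    image-factorization : (posA : IsPosetal 𝒞 A) (posB : IsPosetal 𝒞 B)
      → (retr S · (incl S · check g) ≡ check g) × ((hat g · retr S) · incl S ≡ hat g)
    image-factorization posA posB =
      trans (pullˡ (retr-incl S)) (closure-check posB g) ,
      trans (pullʳ (retr-incl S)) (hat-closure posA g)

  reflection-splitting : (e : Adjunction 𝒞 A C) (m : Adjunction 𝒞 C B)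
    → IsReflection 𝒞 e → IsCoreflection 𝒞 m → Splitting (closure (e ∘ m))
  reflection-splitting {C = C} e m e-reflection m-coreflection = record
    { obj = C
    ; incl = hat e
    ; retr = check e
    ; incl-retr = e-reflection
    ; retr-incl = sym (pullʳ (cancelˡ m-coreflection))
    }

  restrict : {p₁ : Hom A₁ A₁} {p₂ : Hom A₂ A₂}
    (S₁ : Splitting p₁) (S₂ : Splitting p₂) → Hom A₁ A₂ → Hom (obj S₁) (obj S₂)
  restrict S₁ S₂ f = incl S₁ · (f · retr S₂)

  RetrCompatible : Hom A₁ A₁ → Hom A₂ A₂ → Hom A₁ A₂ → Set ℓ
  RetrCompatible p₁ p₂ f = p₁ · (f · p₂) ≡ f · p₂

  InclCompatible : Hom A₁ A₁ → Hom A₂ A₂ → Hom A₁ A₂ → Set ℓ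
  InclCompatible p₁ p₂ f = p₁ · (f · p₂) ≡ p₁ · f

  module _ {p₁ : Hom A₁ A₁} {p₂ : Hom A₂ A₂} (S₁ : Splitting p₁) (S₂ : Splitting p₂) where

    restrict-mono : {f g : Hom A₁ A₂} → f ≤ g → restrict S₁ S₂ f ≤ restrict S₁ S₂ g
    restrict-mono f≤g = ·-mono ≤-refl (·-mono f≤g ≤-refl)

    restrict-congʳ : {f g : Hom A₁ A₂} → f · p₂ ≡ g · p₂
                   → restrict S₁ S₂ f ≡ restrict S₁ S₂ g
    restrict-congʳ {f} {g} eq = ·-congˡ (begin
      f · retr S₂         ≡⟨ ·-congˡ (sym (idem-retr S₂)) ⟩
      f · (p₂ · retr S₂)  ≡⟨ pullˡ eq ⟩
      (g · p₂) · retr S₂  ≡⟨ pullʳ (idem-retr S₂) ⟩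
      g · retr S₂         ∎)

    restrict-congˡ : {f g : Hom A₁ A₂} → p₁ · f ≡ p₁ · g
                   → restrict S₁ S₂ f ≡ restrict S₁ S₂ g
    restrict-congˡ {f} {g} eq = begin
      incl S₁ · (f · retr S₂)         ≡⟨ ·-congʳ (sym (incl-idem S₁)) ⟩
      (incl S₁ · p₁) · (f · retr S₂)  ≡⟨ pullʳ (pullˡ eq) ⟩
      incl S₁ · ((p₁ · g) · retr S₂)  ≡⟨ ·-congˡ ·-assoc ⟩
      incl S₁ · (p₁ · (g · retr S₂))  ≡⟨ pullˡ (incl-idem S₁) ⟩
      incl S₁ · (g · retr S₂)         ∎

    retr-restrict : {f : Hom A₁ A₂} → RetrCompatible p₁ p₂ f
                  → retr S₁ · restrict S₁ S₂ f ≡ f · retr S₂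
    retr-restrict {f} compatible = begin
      retr S₁ · (incl S₁ · (f · retr S₂))  ≡⟨ pullˡ (retr-incl S₁) ⟩
      p₁ · (f · retr S₂)                   ≡⟨ ·-congˡ (·-congˡ (sym (idem-retr S₂))) ⟩
      p₁ · (f · (p₂ · retr S₂))            ≡⟨ ·-congˡ (sym ·-assoc) ⟩
      p₁ · ((f · p₂) · retr S₂)            ≡⟨ pullˡ compatible ⟩
      (f · p₂) · retr S₂                   ≡⟨ pullʳ (idem-retr S₂) ⟩
      f · retr S₂                          ∎

    restrict-incl : {f : Hom A₁ A₂} → InclCompatible p₁ p₂ f
                  → restrict S₁ S₂ f · incl S₂ ≡ incl S₁ · f
    restrict-incl {f} compatible = begin
      (incl S₁ · (f · retr S₂)) · incl S₂  ≡⟨ pullʳ (pullʳ (retr-incl S₂)) ⟩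
      incl S₁ · (f · p₂)                   ≡⟨ ·-congʳ (sym (incl-idem S₁)) ⟩
      (incl S₁ · p₁) · (f · p₂)            ≡⟨ pullʳ compatible ⟩
      incl S₁ · (p₁ · f)                   ≡⟨ pullˡ (incl-idem S₁) ⟩
      incl S₁ · f                          ∎

  restrict-id : {p : Hom A A} (S : Splitting p) → restrict S S id ≡ id
  restrict-id S = trans (·-congˡ ·-identityˡ) (incl-retr S)

  module _ {p₁ : Hom A₁ A₁} {p₂ : Hom A₂ A₂} {p₃ : Hom A₃ A₃}
           (S₁ : Splitting p₁) (S₂ : Splitting p₂) (S₃ : Splitting p₃)
           {f : Hom A₁ A₂} {g : Hom A₂ A₃} where

    restrict-· : restrict S₁ S₂ f · restrict S₂ S₃ g ≡ restrict S₁ S₃ (f · (p₂ · g))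
    restrict-· = begin
      (incl S₁ · (f · retr S₂)) · (incl S₂ · (g · retr S₃))  ≡⟨ pullʳ (pullʳ (pullˡ (retr-incl S₂))) ⟩
      incl S₁ · (f · (p₂ · (g · retr S₃)))                   ≡⟨ ·-congˡ (·-congˡ (sym ·-assoc)) ⟩
      incl S₁ · (f · ((p₂ · g) · retr S₃))                   ≡⟨ ·-congˡ (sym ·-assoc) ⟩
      incl S₁ · ((f · (p₂ · g)) · retr S₃)                   ∎

    restrict-·-retrCompatible : RetrCompatible p₂ p₃ g
      → restrict S₁ S₂ f · restrict S₂ S₃ g ≡ restrict S₁ S₃ (f · g)
    restrict-·-retrCompatible compatible = trans restrict-· (restrict-congʳ S₁ S₃ (begin
      (f · (p₂ · g)) · p₃  ≡⟨ pullʳ ·-assoc ⟩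
      f · (p₂ · (g · p₃))  ≡⟨ ·-congˡ compatible ⟩
      f · (g · p₃)         ≡⟨ sym ·-assoc ⟩
      (f · g) · p₃         ∎))

    restrict-·-inclCompatible : InclCompatible p₁ p₂ f
      → restrict S₁ S₂ f · restrict S₂ S₃ g ≡ restrict S₁ S₃ (f · g)
    restrict-·-inclCompatible compatible = trans restrict-· (restrict-congˡ S₁ S₃ (begin
      p₁ · (f · (p₂ · g))  ≡⟨ ·-congˡ (sym ·-assoc) ⟩
      p₁ · ((f · p₂) · g)  ≡⟨ pullˡ compatible ⟩
      (p₁ · f) · g         ≡⟨ ·-assoc ⟩
      p₁ · (f · g)         ∎))

  restrict-adjunction : {p₁ : Hom A₁ A₁} {p₂ : Hom A₂ A₂} (S₁ : Splitting p₁) (S₂ : Splitting p₂)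
    → id ≤ p₂ → (a : Adjunction 𝒞 A₁ A₂) → RetrCompatible p₁ p₂ (check a)
    → Adjunction 𝒞 (obj S₁) (obj S₂)
  restrict-adjunction {p₂ = p₂} S₁ S₂ id≤p₂ a compatible =
    adj (restrict S₁ S₂ (check a)) (restrict S₂ S₁ (hat a)) unit′ counit′
    where
      unit-through-p₂ : id ≤ check a · (p₂ · hat a)
      unit-through-p₂ = ≤-trans (unit a)
        (·-mono ≤-refl (≤-respˡ-≡ ·-identityˡ (·-mono id≤p₂ ≤-refl)))

      unit′ : id ≤ restrict S₁ S₂ (check a) · restrict S₂ S₁ (hat a)
      unit′ = ≤-respˡ-≡ (restrict-id S₁)
        (≤-respʳ-≡ (sym (restrict-· S₁ S₂ S₁)) (restrict-mono S₁ S₁ unit-through-p₂))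

      counit′ : restrict S₂ S₁ (hat a) · restrict S₁ S₂ (check a) ≤ id
      counit′ = ≤-respˡ-≡ (sym (restrict-·-retrCompatible S₂ S₁ S₂ compatible))
        (≤-respʳ-≡ (restrict-id S₂) (restrict-mono S₂ S₂ (counit a)))

  module _ {p : Hom A A} (S S′ : Splitting p) where

    compare : Hom (obj S) (obj S′)
    compare = incl S · retr S′

    retr-compare : retr S · compare ≡ retr S′
    retr-compare = trans (pullˡ (retr-incl S)) (idem-retr S′)

    compare-incl : compare · incl S′ ≡ incl S
    compare-incl = trans (pullʳ (retr-incl S′)) (incl-idem S)

  compare-inverse : {p : Hom A A} (S S′ : Splitting p) → compare S S′ · compare S′ S ≡ id
  compare-inverse S S′ =
    trans (pullʳ (pullˡ (retr-incl S′))) (trans (·-congˡ (idem-retr S)) (incl-retr S))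

  comparison : {p : Hom A A} (S S′ : Splitting p) → Adjunction 𝒞 (obj S) (obj S′)
  comparison S S′ = adj (compare S S′) (compare S′ S)
    (≤-reflexive (sym (compare-inverse S S′))) (≤-reflexive (compare-inverse S′ S))

  compare-natural : {p₁ : Hom A₁ A₁} {p₂ : Hom A₂ A₂}
    (S₁ S₁′ : Splitting p₁) (S₂ S₂′ : Splitting p₂) {f : Hom A₁ A₂}
    → restrict S₁ S₂ f · compare S₂ S₂′ ≡ compare S₁ S₁′ · restrict S₁′ S₂′ f
  compare-natural S₁ S₁′ S₂ S₂′ =
    trans (pullʳ (pullʳ (retr-compare S₂ S₂′))) (sym (pullˡ (compare-incl S₁ S₁′)))

  check-retrCompatible : (g₁ : Adjunction 𝒞 A₁ B₁) (g₂ : Adjunction 𝒞 A₂ B₂) → IsPosetal 𝒞 B₁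
    → {f : Hom A₁ A₂} {h : Hom B₁ B₂} → f · check g₂ ≡ check g₁ · h
    → RetrCompatible (closure g₁) (closure g₂) f
  check-retrCompatible g₁ g₂ posB₁ {f} {h} square = begin
    closure g₁ · (f · closure g₂)          ≡⟨ ·-congˡ (pullˡ square) ⟩
    closure g₁ · ((check g₁ · h) · hat g₂) ≡⟨ ·-congˡ ·-assoc ⟩
    closure g₁ · (check g₁ · (h · hat g₂)) ≡⟨ pullˡ (closure-check posB₁ g₁) ⟩
    check g₁ · (h · hat g₂)                ≡⟨ sym ·-assoc ⟩
    (check g₁ · h) · hat g₂                ≡⟨ sym (pullˡ square) ⟩
    f · closure g₂                         ∎

  hat-inclCompatible : (g₁ : Adjunction 𝒞 A₁ B₁) (g₂ : Adjunction 𝒞 A₂ B₂) → IsPosetal 𝒞 A₁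
    → {f : Hom A₂ A₁} {h : Hom B₂ B₁} → hat g₂ · f ≡ h · hat g₁
    → InclCompatible (closure g₂) (closure g₁) f
  hat-inclCompatible g₁ g₂ posA₁ {f} {h} square = begin
    closure g₂ · (f · closure g₁)          ≡⟨ pullʳ (pullˡ square) ⟩
    check g₂ · ((h · hat g₁) · closure g₁) ≡⟨ ·-congˡ (pullʳ (hat-closure posA₁ g₁)) ⟩
    check g₂ · (h · hat g₁)                ≡⟨ ·-congˡ (sym square) ⟩
    check g₂ · (hat g₂ · f)                ≡⟨ sym ·-assoc ⟩
    closure g₂ · f                         ∎

  module _ (split : ∀ {A} (p : Hom A A) → p · p ≡ p → Splitting p) where

    private
      Fact : Set (o ⊔ ℓ ⊔ r)
      Fact = FactObj (AdjCat 𝒞) (IsReflection 𝒞) (IsCoreflection 𝒞)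

      FactMap : Fact → Fact → Set (ℓ ⊔ r)
      FactMap = FactHom (AdjCat 𝒞) (IsReflection 𝒞) (IsCoreflection 𝒞)

      compose : Functor (RefCoref 𝒞) (AdjArrow 𝒞)
      compose = composite (AdjCat 𝒞) (IsReflection 𝒞) (IsCoreflection 𝒞)

    module Image (X : ArrowObj (AdjCat 𝒞)) where
      open ArrowObj X public using (dom; cod) renaming (arr to g)

      S : Splitting (closure g)
      S = split (closure g) (closure-idem (proj₂ dom) g)

      reflection : Adjunction 𝒞 (proj₁ dom) (obj S)
      reflection = splitting-reflection (unit g) S

      coreflection : Adjunction 𝒞 (obj S) (proj₁ cod)
      coreflection = image-coreflection g S (proj₂ cod)

      factors : (check (reflection ∘ coreflection) ≡ check g)
              × (hat (reflection ∘ coreflection) ≡ hat g)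
      factors = image-factorization g S (proj₂ dom) (proj₂ cod)

      factorization : Fact
      factorization = factObj dom (obj S , splitting-posetal (proj₂ dom) S) cod
        reflection coreflection (incl-retr S) (image-coreflection-retracts g S)

    module ImageMap {X Y : ArrowObj (AdjCat 𝒞)} (f : ArrowHom (AdjCat 𝒞) X Y) where
      private
        module X = Image X
        module Y = Image Y
      open ArrowHom f using (commute) renaming (top to a; bot to b)

      check-compatible : RetrCompatible (closure X.g) (closure Y.g) (check a)
      check-compatible = check-retrCompatible X.g Y.g (proj₂ X.cod) (proj₁ commute)

      hat-compatible : InclCompatible (closure Y.g) (closure X.g) (hat a)
      hat-compatible = hat-inclCompatible X.g Y.g (proj₂ X.dom) (proj₂ commute)

      middle : Adjunction 𝒞 (obj X.S) (obj Y.S)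
      middle = restrict-adjunction X.S Y.S (unit Y.g) a check-compatible

      coreflection-check : restrict X.S Y.S (check a) · (incl Y.S · check Y.g)
                         ≡ (incl X.S · check X.g) · check b
      coreflection-check = begin
        restrict X.S Y.S (check a) · (incl Y.S · check Y.g)  ≡⟨ pullʳ (pullʳ (pullˡ (retr-incl Y.S))) ⟩
        incl X.S · (check a · (closure Y.g · check Y.g))     ≡⟨ ·-congˡ (·-congˡ (closure-check (proj₂ Y.cod) Y.g)) ⟩
        incl X.S · (check a · check Y.g)                     ≡⟨ ·-congˡ (proj₁ commute) ⟩
        incl X.S · (check X.g · check b)                     ≡⟨ sym ·-assoc ⟩
        (incl X.S · check X.g) · check b                     ∎

      coreflection-hat : (hat Y.g · retr Y.S) · restrict Y.S X.S (hat a)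
                       ≡ hat b · (hat X.g · retr X.S)
      coreflection-hat = begin
        (hat Y.g · retr Y.S) · restrict Y.S X.S (hat a)  ≡⟨ pullʳ (pullˡ (retr-incl Y.S)) ⟩
        hat Y.g · (closure Y.g · (hat a · retr X.S))     ≡⟨ pullˡ (hat-closure (proj₂ Y.dom) Y.g) ⟩
        hat Y.g · (hat a · retr X.S)                     ≡⟨ pullˡ (proj₂ commute) ⟩
        (hat b · hat X.g) · retr X.S                     ≡⟨ ·-assoc ⟩
        hat b · (hat X.g · retr X.S)                     ∎

      hom : FactMap X.factorization Y.factorization
      hom = factHom a middle b
        (sym (retr-restrict X.S Y.S check-compatible) , sym (restrict-incl Y.S X.S hat-compatible))
        (coreflection-check , coreflection-hat)

    image : Functor (AdjArrow 𝒞) (RefCoref 𝒞)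
    image = record
      { F₀ = Image.factorization
      ; F₁ = ImageMap.hom
      ; identity = λ {X} →
          (refl , refl) , (restrict-id (Image.S X) , restrict-id (Image.S X)) , (refl , refl)
      ; homomorphism = λ {X} {Y} {Z} {f} {g} →
          (refl , refl)
          , ( sym (restrict-·-retrCompatible (Image.S X) (Image.S Y) (Image.S Z) (ImageMap.check-compatible g))
            , sym (restrict-·-inclCompatible (Image.S Z) (Image.S Y) (Image.S X) (ImageMap.hat-compatible g)))
          , (refl , refl)
      ; F-resp-≈ = λ {X} {Y} (top≈ , bot≈) →
          top≈ , (cong (restrict (Image.S X) (Image.S Y)) (proj₁ top≈)
                 , cong (restrict (Image.S Y) (Image.S X)) (proj₂ top≈)) , bot≈
      }

    image-unit : NaturalIsomorphism idF (image ⨾F compose)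
    image-unit = record
      { η = λ X → let (check≡ , hat≡) = Image.factors X in
          arrHom (idAdj 𝒞) (idAdj 𝒞) (id-square check≡ , sym (id-square (sym hat≡)))
      ; η⁻¹ = λ X → let (check≡ , hat≡) = Image.factors X in
          arrHom (idAdj 𝒞) (idAdj 𝒞) (id-square (sym check≡) , sym (id-square hat≡))
      ; isoˡ = λ _ → (·-identityˡ , ·-identityˡ) , (·-identityˡ , ·-identityˡ)
      ; isoʳ = λ _ → (·-identityˡ , ·-identityˡ) , (·-identityˡ , ·-identityˡ)
      ; natural = λ _ → (id-comm , sym id-comm) , (id-comm , sym id-comm)
      }

    module Counit (X : Fact) where
      open FactObj X using (left; right; left∈E; right∈M)
      module GX = Image (Functor.F₀ compose X)

      S′ : Splitting (closure (left ∘ right))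
      S′ = reflection-splitting left right left∈E right∈M

      to : FactMap GX.factorization X
      to = factHom (idAdj 𝒞) (comparison GX.S S′) (idAdj 𝒞)
        ( trans ·-identityˡ (sym (retr-compare GX.S S′))
        , trans ·-identityʳ (sym (compare-incl S′ GX.S)))
        (trans ·-assoc (sym ·-identityʳ) , trans (sym ·-assoc) (sym ·-identityˡ))

      from : FactMap X GX.factorization
      from = factHom (idAdj 𝒞) (comparison S′ GX.S) (idAdj 𝒞)
        ( trans ·-identityˡ (sym (retr-compare S′ GX.S))
        , trans ·-identityʳ (sym (compare-incl GX.S S′)))
        ( trans (·-congˡ (sym ·-assoc)) (trans (cancelˡ (compare-inverse S′ GX.S)) (sym ·-identityʳ))
        , trans (·-congʳ ·-assoc) (trans (cancelʳ (compare-inverse S′ GX.S)) (sym ·-identityˡ)))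

    module CounitNaturality {X Y : Fact} (f : FactMap X Y) where
      private
        module X = Counit X
        module Y = Counit Y
      open FactHom f using (commuteˡ) renaming (hdom to a; hmid to c)

      restrict-check : restrict X.S′ Y.S′ (check a) ≡ check c
      restrict-check = trans (·-congˡ (proj₁ commuteˡ)) (cancelˡ (FactObj.left∈E X))

      restrict-hat : restrict Y.S′ X.S′ (hat a) ≡ hat c
      restrict-hat = trans (pullˡ (proj₂ commuteˡ)) (cancelʳ (FactObj.left∈E X))

      check-natural : restrict X.GX.S Y.GX.S (check a) · compare Y.GX.S Y.S′
                    ≡ compare X.GX.S X.S′ · check c
      check-natural = trans (compare-natural X.GX.S X.S′ Y.GX.S Y.S′) (·-congˡ restrict-check)

      hat-natural : compare Y.S′ Y.GX.S · restrict Y.GX.S X.GX.S (hat a)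
                  ≡ hat c · compare X.S′ X.GX.S
      hat-natural = trans (sym (compare-natural Y.S′ Y.GX.S X.S′ X.GX.S)) (·-congʳ restrict-hat)

    image-counit : NaturalIsomorphism (compose ⨾F image) idF
    image-counit = record
      { η = Counit.to
      ; η⁻¹ = Counit.from
      ; isoˡ = λ X → let open Counit X in
          (·-identityˡ , ·-identityˡ) , (compare-inverse GX.S S′ , compare-inverse GX.S S′)
          , (·-identityˡ , ·-identityˡ)
      ; isoʳ = λ X → let open Counit X in
          (·-identityˡ , ·-identityˡ) , (compare-inverse S′ GX.S , compare-inverse S′ GX.S)
          , (·-identityˡ , ·-identityˡ)
      ; natural = λ f → let open CounitNaturality f in
          (id-comm , sym id-comm) , (check-natural , hat-natural) , (id-comm , sym id-comm)
      }

    equivalence : Equivalence (AdjArrow 𝒞) (RefCoref 𝒞)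
    equivalence = record { F = image ; G = compose ; unit = image-unit ; counit = image-counit }

mainTheorem4 : ∀ {o ℓ r} (𝒞 : CSCategory o ℓ r)
    → Equivalence (AdjArrow (CSCategory.cat 𝒞)) (RefCoref (CSCategory.cat 𝒞))
mainTheorem4 𝒞 = equivalence cat (λ p idem → equalizer-splitting cat idem (equalizers p id))
  where
    open CSCategory 𝒞
    open OrderEnrichedCategory cat using (id)
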